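{- For every integer $d \geq 1$, every $k \in \{0,\ldots,d-1\}$ and every $j \in \{0,\ldots,d\}$, we have $c_{d,k}(j) \leq c_{d,k+1}(j)$.
   Context: For integers $d \geq 1$ and $k \in \{0,\ldots,d\}$, let $P_{d,k}$ be the polynomial determined by $\sum_{n \geq 0} P_{d,k}(n)\, x^n = \frac{(1+x)^k}{(1-x)^{d+1}}$. The numbers $c_{d,k}(j)$ are defined by $d!\, P_{d,k}(n) = \sum_{j=0}^d c_{d,k}(j)\, n^j$. -}

module Defs where

open import Data.Nat as ℕ using (ℕ; zero; suc; _∸_)
open import Data.Nat.Combinatorics using (_C_)
open import Data.Integer as ℤ using (ℤ; +_)
open import Data.Fin using (Fin; toℕ)
import Data.Fin as Fin
open import Relation.Binary.PropositionalEquality using (_≡_)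

sumTo : ℕ → (ℕ → ℕ) → ℕ
sumTo zero    f = f 0
sumTo (suc n) f = sumTo n f ℕ.+ f (suc n)

sumFin : (m : ℕ) → (Fin m → ℤ) → ℤ
sumFin zero    f = + 0
sumFin (suc m) f = f Fin.zero ℤ.+ sumFin m (λ j → f (Fin.suc j))

-- Coefficient of x^n in 1/(1-x)^(d+1) is C(n+d, d); coefficient of x^i in (1+x)^k
-- is C(k,i).  P d k n = coefficient of x^n in (1+x)^k/(1-x)^(d+1) (Cauchy product).
P : ℕ → ℕ → ℕ → ℕ
P d k n = sumTo n (λ i → (k C i) ℕ.* (((n ∸ i) ℕ.+ d) C d))

-- c : Fin (d+1) → ℤ are the coefficients c_{d,k}(0..d) of d! P_{d,k}(n) = Σ_j c(j) n^j
IsCoeffs : (d k : ℕ) → (Fin (suc d) → ℤ) → Set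
IsCoeffs d k c = ∀ (n : ℕ) → + ((d ℕ.!) ℕ.* P d k n) ≡ sumFin (suc d) (λ j → c j ℤ.* ((+ n) ℤ.^ toℕ j))

-- The difference c_{d,k+1}(j) - c_{d,k}(j) is the j-th coefficient of d!(P_{d,k+1}(n) - P_{d,k}(n)) =
-- d! P_{d,k}(n-1), the coefficient of xⁿ in x(1+x)ᵏ/(1-x)^(d+1); as polynomial coefficients are unique,
-- it suffices that this is a polynomial in n with nonnegative coefficients. For fixed e = d - k - 1,
-- Gₖ(n) = d! P_{d,k}(n-1) satisfies
--   G₀ = n(n+1)⋯(n+e),   G₁ = (2n+e) G₀,   Gₖ₊₂ = (2n+e) Gₖ₊₁ + (k+1)(k+e+2) Gₖ,
-- a recurrence with nonnegative coefficients, which follows by induction on n from Pascal's rule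
-- for the binomial factors of P in k and in d.

module Submission where

open import Defs
open import Data.Nat using (ℕ; suc; _≤_; _<_)
open import Data.Integer using (ℤ)
import Data.Integer as ℤ
open import Data.Fin using (Fin)
open import Data.Product using (Σ; _×_)

module NatPolynomials where

  open import Data.Nat
  open import Data.Nat.Properties
  open import Data.List using (List; []; _∷_; length; map)
  open import Data.List.Properties using (length-map)
  open import Data.Nat.Tactic.RingSolver using (solve-∀)
  open import Relation.Binary.PropositionalEquality

  horner : List ℕ → ℕ → ℕ
  horner []      x = 0
  horner (a ∷ p) x = a + x * horner p x

  infixl 6 _⊕_
  _⊕_ : List ℕ → List ℕ → List ℕ
  []      ⊕ q       = q
  (a ∷ p) ⊕ []      = a ∷ p
  (a ∷ p) ⊕ (b ∷ q) = a + b ∷ p ⊕ q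

  horner-⊕ : ∀ p q x → horner (p ⊕ q) x ≡ horner p x + horner q x
  horner-⊕ []      q       x = refl
  horner-⊕ (a ∷ p) []      x = sym (+-identityʳ _)
  horner-⊕ (a ∷ p) (b ∷ q) x rewrite horner-⊕ p q x = regroup a b x (horner p x) (horner q x)
    where
    regroup : ∀ a b x u v → a + b + x * (u + v) ≡ a + x * u + (b + x * v)
    regroup = solve-∀

  length-⊕ : ∀ p q → length (p ⊕ q) ≡ length p ⊔ length q
  length-⊕ []      q       = refl
  length-⊕ (a ∷ p) []      = refl
  length-⊕ (a ∷ p) (b ∷ q) = cong suc (length-⊕ p q)

  horner-scale : ∀ c p x → horner (map (c *_) p) x ≡ c * horner p x
  horner-scale c []      x = sym (*-zeroʳ c)
  horner-scale c (a ∷ p) x rewrite horner-scale c p x = regroup c a x (horner p x)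
    where
    regroup : ∀ c a x u → c * a + x * (c * u) ≡ c * (a + x * u)
    regroup = solve-∀

  record NatPoly (d : ℕ) (f : ℕ → ℕ) : Set where
    constructor natPoly
    field
      coeffs   : List ℕ
      length≤  : length coeffs ≤ suc d
      horner-≡ : ∀ n → f n ≡ horner coeffs n

  open NatPoly public

  NatPoly-cong : ∀ {d f g} → (∀ n → f n ≡ g n) → NatPoly d f → NatPoly d g
  NatPoly-cong f≗g (natPoly p len eval) = natPoly p len (λ n → trans (sym (f≗g n)) (eval n))

  NatPoly-const : ∀ c → NatPoly 0 (λ _ → c)
  NatPoly-const c = natPoly (c ∷ []) ≤-refl (λ n → sym (trans (cong (c +_) (*-zeroʳ n)) (+-identityʳ c)))

  NatPoly-weaken : ∀ {d d′ f} → d ≤ d′ → NatPoly d f → NatPoly d′ f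
  NatPoly-weaken d≤d′ (natPoly p len eval) = natPoly p (≤-trans len (s≤s d≤d′)) eval

  NatPoly-+ : ∀ {d f g} → NatPoly d f → NatPoly d g → NatPoly d (λ n → f n + g n)
  NatPoly-+ (natPoly p lenp evalp) (natPoly q lenq evalq) = natPoly (p ⊕ q)
    (subst (_≤ _) (sym (length-⊕ p q)) (⊔-lub lenp lenq))
    (λ n → trans (cong₂ _+_ (evalp n) (evalq n)) (sym (horner-⊕ p q n)))

  NatPoly-scale : ∀ {d f} c → NatPoly d f → NatPoly d (λ n → c * f n)
  NatPoly-scale c (natPoly p len eval) = natPoly (map (c *_) p)
    (subst (_≤ _) (sym (length-map (c *_) p)) len)
    (λ n → trans (cong (c *_) (eval n)) (sym (horner-scale c p n)))

  NatPoly-*-linear : ∀ {d f} a b → NatPoly d f → NatPoly (suc d) (λ n → (a * n + b) * f n)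
  NatPoly-*-linear {f = f} a b poly@(natPoly p len eval) = NatPoly-cong (λ n → expand a b n (f n))
    (NatPoly-+ (NatPoly-scale a (natPoly (0 ∷ p) (s≤s len) (λ n → cong (n *_) (eval n))))
               (NatPoly-weaken (n≤1+n _) (NatPoly-scale b poly)))
    where
    expand : ∀ a b n y → a * (n * y) + b * y ≡ (a * n + b) * y
    expand = solve-∀


module IntegerEvaluation where

  open NatPolynomials using (horner; NatPoly; coeffs; length≤; horner-≡)
  open import Data.Nat as ℕ using (zero)
  import Data.Nat.Properties as ℕ
  open import Data.Nat.Divisibility as ℕ using (divides; >⇒∤)
  open import Data.Integer using (+_; ∣_∣; _+_; _-_; _*_; _^_)
  open import Data.Integer.Properties
  open import Algebra.Bundles using (AbelianGroup)
  open import Algebra.Properties.Group (AbelianGroup.group +-0-abelianGroup)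
    using () renaming (∙-cancelˡ to +-cancelˡ)
  import Data.Fin as Fin
  open import Data.Fin using (toℕ)
  open import Data.List using (List; []; _∷_; length)
  open import Data.Empty using (⊥-elim)
  open import Data.Product using (_,_)
  open import Data.Integer.Tactic.RingSolver using (solve-∀)
  open import Relation.Binary.PropositionalEquality

  evalℤ : (m : ℕ) → (Fin m → ℤ) → ℕ → ℤ
  evalℤ m c n = sumFin m (λ j → c j * (+ n) ^ toℕ j)

  sumFin-cong : ∀ m {f g : Fin m → ℤ} → (∀ j → f j ≡ g j) → sumFin m f ≡ sumFin m g
  sumFin-cong zero    f≗g = refl
  sumFin-cong (suc m) f≗g = cong₂ _+_ (f≗g Fin.zero) (sumFin-cong m (λ j → f≗g (Fin.suc j)))

  sumFin-+ : ∀ m (f g : Fin m → ℤ) → sumFin m (λ j → f j + g j) ≡ sumFin m f + sumFin m g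
  sumFin-+ zero    f g = refl
  sumFin-+ (suc m) f g rewrite sumFin-+ m (λ j → f (Fin.suc j)) (λ j → g (Fin.suc j)) =
    +-+-comm (f Fin.zero) (g Fin.zero) _ _
    where
    +-+-comm : ∀ a b c d → a + b + (c + d) ≡ a + c + (b + d)
    +-+-comm = solve-∀

  sumFin-*ˡ : ∀ m x (f : Fin m → ℤ) → sumFin m (λ j → x * f j) ≡ x * sumFin m f
  sumFin-*ˡ zero    x f = sym (*-zeroʳ x)
  sumFin-*ˡ (suc m) x f rewrite sumFin-*ˡ m x (λ j → f (Fin.suc j)) = sym (*-distribˡ-+ x (f Fin.zero) _)

  evalℤ-+ : ∀ m (a b : Fin m → ℤ) n → evalℤ m (λ j → a j + b j) n ≡ evalℤ m a n + evalℤ m b n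
  evalℤ-+ m a b n = trans (sumFin-cong m (λ j → *-distribʳ-+ ((+ n) ^ toℕ j) (a j) (b j))) (sumFin-+ m _ _)

  evalℤ-suc : ∀ m (c : Fin (suc m) → ℤ) n →
              evalℤ (suc m) c n ≡ c Fin.zero + + n * evalℤ m (λ j → c (Fin.suc j)) n
  evalℤ-suc m c n = cong₂ _+_ (*-identityʳ (c Fin.zero))
    (trans (sumFin-cong m (λ j → regroup (c (Fin.suc j)) (+ n) ((+ n) ^ toℕ j)))
           (sumFin-*ˡ m (+ n) (λ j → c (Fin.suc j) * (+ n) ^ toℕ j)))
    where
    regroup : ∀ a x y → a * (x * y) ≡ x * (a * y)
    regroup = solve-∀

  coef : List ℕ → ℕ → ℕ
  coef []      i       = 0
  coef (a ∷ p) zero    = a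
  coef (a ∷ p) (suc i) = coef p i

  coeffsℤ : (m : ℕ) → List ℕ → Fin m → ℤ
  coeffsℤ m p j = + coef p (toℕ j)

  evalℤ-horner : ∀ m p n → length p ℕ.≤ m → evalℤ m (coeffsℤ m p) n ≡ + horner p n
  evalℤ-horner zero    []      n _ = refl
  evalℤ-horner (suc m) []      n _ = begin
    evalℤ (suc m) (coeffsℤ (suc m) []) n        ≡⟨ evalℤ-suc m (coeffsℤ (suc m) []) n ⟩
    + 0 + + n * evalℤ m (coeffsℤ m []) n        ≡⟨ cong (λ z → + 0 + + n * z) (evalℤ-horner m [] n ℕ.z≤n) ⟩
    + 0 + + n * + 0                             ≡⟨ cong (_+_ (+ 0)) (*-zeroʳ (+ n)) ⟩
    + 0                                         ∎
    where open ≡-Reasoning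
  evalℤ-horner (suc m) (a ∷ p) n (ℕ.s≤s len) = begin
    evalℤ (suc m) (coeffsℤ (suc m) (a ∷ p)) n   ≡⟨ evalℤ-suc m (coeffsℤ (suc m) (a ∷ p)) n ⟩
    + a + + n * evalℤ m (coeffsℤ m p) n         ≡⟨ cong (λ z → + a + + n * z) (evalℤ-horner m p n len) ⟩
    + a + + n * + horner p n                    ≡⟨ cong (_+_ (+ a)) (pos-* n (horner p n)) ⟨
    + a + + (n ℕ.* horner p n)                  ≡⟨ pos-+ a _ ⟨
    + horner (a ∷ p) n                          ∎
    where open ≡-Reasoning

  natPoly⇒coeffs : ∀ {d f} → NatPoly d f → Σ (Fin (suc d) → ℤ) λ c → ∀ n → + f n ≡ evalℤ (suc d) c n
  natPoly⇒coeffs poly = coeffsℤ _ (coeffs poly) , λ n →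
    trans (cong +_ (horner-≡ poly n)) (sym (evalℤ-horner _ (coeffs poly) n (length≤ poly)))

  divisible-by-all⇒0 : ∀ m → (∀ n → suc n ℕ.∣ m) → m ≡ 0
  divisible-by-all⇒0 zero    _     = refl
  divisible-by-all⇒0 (suc m) all∣m = ⊥-elim (>⇒∤ (ℕ.n<1+n (suc m)) (all∣m (suc m)))

  -- Comparing at n = |a₀ - b₀| + 1 forces the constant terms to agree; cancelling n then gives the tails.
  evalℤ-injective : ∀ m (a b : Fin m → ℤ) → (∀ n → evalℤ m a (suc n) ≡ evalℤ m b (suc n)) → ∀ j → a j ≡ b j
  evalℤ-injective (suc m) a b a≗b = λ where
      Fin.zero    → a₀≡b₀
      (Fin.suc j) → evalℤ-injective m aᵗ bᵗ tails j
    where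
    a₀ = a Fin.zero
    b₀ = b Fin.zero
    aᵗ bᵗ : Fin m → ℤ
    aᵗ j = a (Fin.suc j)
    bᵗ j = b (Fin.suc j)
    split : ∀ n → a₀ + + suc n * evalℤ m aᵗ (suc n) ≡ b₀ + + suc n * evalℤ m bᵗ (suc n)
    split n = trans (sym (evalℤ-suc m a (suc n))) (trans (a≗b n) (evalℤ-suc m b (suc n)))
    difference : ∀ n → a₀ - b₀ ≡ + suc n * (evalℤ m bᵗ (suc n) - evalℤ m aᵗ (suc n))
    difference n = begin
      a₀ - b₀                       ≡⟨ regroup₁ a₀ b₀ x (evalℤ m aᵗ (suc n)) ⟩
      (a₀ + x * evalℤ m aᵗ (suc n)) - x * evalℤ m aᵗ (suc n) - b₀
        ≡⟨ cong (λ z → z - x * evalℤ m aᵗ (suc n) - b₀) (split n) ⟩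
      (b₀ + x * evalℤ m bᵗ (suc n)) - x * evalℤ m aᵗ (suc n) - b₀
        ≡⟨ regroup₂ b₀ x (evalℤ m aᵗ (suc n)) (evalℤ m bᵗ (suc n)) ⟩
      x * (evalℤ m bᵗ (suc n) - evalℤ m aᵗ (suc n)) ∎
      where
      open ≡-Reasoning
      x = + suc n
      regroup₁ : ∀ a b x t → a - b ≡ (a + x * t) - x * t - b
      regroup₁ = solve-∀
      regroup₂ : ∀ b x s t → (b + x * t) - x * s - b ≡ x * (t - s)
      regroup₂ = solve-∀
    suc∣a₀-b₀ : ∀ n → suc n ℕ.∣ ∣ a₀ - b₀ ∣
    suc∣a₀-b₀ n =
      divides ∣ t ∣ (trans (cong ∣_∣ (difference n)) (trans (abs-* (+ suc n) t) (ℕ.*-comm (suc n) ∣ t ∣)))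
      where t = evalℤ m bᵗ (suc n) - evalℤ m aᵗ (suc n)
    a₀≡b₀ : a₀ ≡ b₀
    a₀≡b₀ = i-j≡0⇒i≡j a₀ b₀ (∣i∣≡0⇒i≡0 (divisible-by-all⇒0 _ suc∣a₀-b₀))
    tails : ∀ n → evalℤ m aᵗ (suc n) ≡ evalℤ m bᵗ (suc n)
    tails n = *-cancelˡ-≡ (+ suc n) _ _
      (+-cancelˡ a₀ _ _ (trans (split n) (cong (_+ + suc n * evalℤ m bᵗ (suc n)) (sym a₀≡b₀))))


module Combinatorics where

  open NatPolynomials
  open import Data.Nat
  open import Data.Nat.Properties
  open import Data.Nat.Combinatorics using (_C_; nCn≡1; nC1≡n; nCk+nC[k+1]≡[n+1]C[k+1])
  open import Data.Product using (_,_; proj₁; proj₂)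
  open import Data.Nat.Tactic.RingSolver using (solve-∀)
  open import Relation.Binary.PropositionalEquality

  sumTo-cong : ∀ n {f g : ℕ → ℕ} → (∀ i → i ≤ n → f i ≡ g i) → sumTo n f ≡ sumTo n g
  sumTo-cong zero    f≗g = f≗g 0 z≤n
  sumTo-cong (suc n) f≗g =
    cong₂ _+_ (sumTo-cong n (λ i i≤n → f≗g i (m≤n⇒m≤1+n i≤n))) (f≗g (suc n) ≤-refl)

  sumTo-+ : ∀ n (f g : ℕ → ℕ) → sumTo n (λ i → f i + g i) ≡ sumTo n f + sumTo n g
  sumTo-+ zero    f g = refl
  sumTo-+ (suc n) f g rewrite sumTo-+ n f g = +-+-comm (sumTo n f) (sumTo n g) (f (suc n)) (g (suc n))
    where
    +-+-comm : ∀ a b c d → a + b + (c + d) ≡ a + c + (b + d)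
    +-+-comm = solve-∀

  sumTo-suc : ∀ n (f : ℕ → ℕ) → sumTo (suc n) f ≡ f 0 + sumTo n (λ i → f (suc i))
  sumTo-suc zero    f = refl
  sumTo-suc (suc n) f rewrite sumTo-suc n f = +-assoc (f 0) _ _

  conv : (ℕ → ℕ) → (ℕ → ℕ) → ℕ → ℕ
  conv a b n = sumTo n (λ i → a i * b (n ∸ i))

  conv-pascalˡ : ∀ {a a′ b : ℕ → ℕ} → a′ 0 ≡ a 0 → (∀ i → a′ (suc i) ≡ a (suc i) + a i) →
                 ∀ n → conv a′ b (suc n) ≡ conv a b (suc n) + conv a b n
  conv-pascalˡ {a} {a′} {b} a′0≡a0 a′-suc n = begin
    conv a′ b (suc n)
      ≡⟨ sumTo-suc n _ ⟩
    a′ 0 * b (suc n) + sumTo n (λ i → a′ (suc i) * b (n ∸ i))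
      ≡⟨ cong₂ _+_ (cong (_* b (suc n)) a′0≡a0) (sumTo-cong n split) ⟩
    a 0 * b (suc n) + sumTo n (λ i → a (suc i) * b (n ∸ i) + a i * b (n ∸ i))
      ≡⟨ cong (a 0 * b (suc n) +_) (sumTo-+ n _ _) ⟩
    a 0 * b (suc n) + (sumTo n (λ i → a (suc i) * b (n ∸ i)) + conv a b n)
      ≡⟨ +-assoc (a 0 * b (suc n)) _ _ ⟨
    a 0 * b (suc n) + sumTo n (λ i → a (suc i) * b (n ∸ i)) + conv a b n
      ≡⟨ cong (_+ conv a b n) (sumTo-suc n _) ⟨
    conv a b (suc n) + conv a b n ∎
    where
    open ≡-Reasoning
    split : ∀ i → i ≤ n → a′ (suc i) * b (n ∸ i) ≡ a (suc i) * b (n ∸ i) + a i * b (n ∸ i)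
    split i _ = trans (cong (_* b (n ∸ i)) (a′-suc i)) (*-distribʳ-+ (b (n ∸ i)) (a (suc i)) (a i))

  conv-pascalʳ : ∀ {a b b′ : ℕ → ℕ} → b′ 0 ≡ b 0 → (∀ m → b′ (suc m) ≡ b′ m + b (suc m)) →
                 ∀ n → conv a b′ (suc n) ≡ conv a b′ n + conv a b (suc n)
  conv-pascalʳ {a} {b} {b′} b′0≡b0 b′-suc n = begin
    sumTo n (λ i → a i * b′ (suc n ∸ i)) + a (suc n) * b′ (n ∸ n)
      ≡⟨ cong₂ _+_ (sumTo-cong n split) (cong (a (suc n) *_) last) ⟩
    sumTo n (λ i → a i * b′ (n ∸ i) + a i * b (suc n ∸ i)) + a (suc n) * b (n ∸ n)
      ≡⟨ cong (_+ a (suc n) * b (n ∸ n)) (sumTo-+ n _ _) ⟩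
    conv a b′ n + sumTo n (λ i → a i * b (suc n ∸ i)) + a (suc n) * b (n ∸ n)
      ≡⟨ +-assoc (conv a b′ n) _ _ ⟩
    conv a b′ n + conv a b (suc n) ∎
    where
    open ≡-Reasoning
    last : b′ (n ∸ n) ≡ b (n ∸ n)
    last = subst (λ m → b′ m ≡ b m) (sym (n∸n≡0 n)) b′0≡b0
    split : ∀ i → i ≤ n → a i * b′ (suc n ∸ i) ≡ a i * b′ (n ∸ i) + a i * b (suc n ∸ i)
    split i i≤n = begin
      a i * b′ (suc n ∸ i)              ≡⟨ cong (λ m → a i * b′ m) suc-∸ ⟩
      a i * b′ (suc (n ∸ i))            ≡⟨ cong (a i *_) (b′-suc (n ∸ i)) ⟩
      a i * (b′ (n ∸ i) + b (suc (n ∸ i))) ≡⟨ *-distribˡ-+ (a i) _ _ ⟩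
      a i * b′ (n ∸ i) + a i * b (suc (n ∸ i)) ≡⟨ cong (λ m → a i * b′ (n ∸ i) + a i * b m) suc-∸ ⟨
      a i * b′ (n ∸ i) + a i * b (suc n ∸ i) ∎
      where
      suc-∸ : suc n ∸ i ≡ suc (n ∸ i)
      suc-∸ = +-∸-assoc 1 i≤n

  C-absorb : ∀ n k → suc k * (suc n C suc k) ≡ suc n * (n C k)
  C-absorb zero    zero    = refl
  C-absorb zero    (suc k) = *-zeroʳ (suc (suc k))
  C-absorb (suc n) zero    = trans (*-identityˡ _) (trans (nC1≡n (suc (suc n))) (sym (*-identityʳ _)))
  C-absorb (suc n) (suc k) = begin
    suc (suc k) * (suc (suc n) C suc (suc k))
      ≡⟨ cong (suc (suc k) *_) (nCk+nC[k+1]≡[n+1]C[k+1] (suc n) (suc k)) ⟨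
    suc (suc k) * (x + y)
      ≡⟨ rearrange₁ k x y ⟩
    x + suc k * x + suc (suc k) * y
      ≡⟨ cong₂ (λ u v → x + u + v) (C-absorb n k) (C-absorb n (suc k)) ⟩
    x + suc n * (n C k) + suc n * (n C suc k)
      ≡⟨ rearrange₂ n x (n C k) (n C suc k) ⟩
    x + suc n * (n C k + n C suc k)
      ≡⟨ cong (λ z → x + suc n * z) (nCk+nC[k+1]≡[n+1]C[k+1] n k) ⟩
    x + suc n * x
      ∎
    where
    open ≡-Reasoning
    x = suc n C suc k
    y = suc n C suc (suc k)
    rearrange₁ : ∀ k x y → suc (suc k) * (x + y) ≡ x + suc k * x + suc (suc k) * y
    rearrange₁ = solve-∀
    rearrange₂ : ∀ n x u v → x + suc n * u + suc n * v ≡ x + suc n * (u + v)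
    rearrange₂ = solve-∀

  P-at-zero : ∀ d k → P d k 0 ≡ 1
  P-at-zero d k = trans (*-identityˡ (d C d)) (nCn≡1 d)

  P-binomial : ∀ d n → P d 0 n ≡ (n + d) C d
  P-binomial d zero    = *-identityˡ (d C d)
  P-binomial d (suc n) = begin
    P d 0 (suc n)                          ≡⟨ sumTo-suc n _ ⟩
    1 * ((suc n + d) C d) + sumTo n (λ _ → 0) ≡⟨ cong₂ _+_ (*-identityˡ _) (sumTo-zero n) ⟩
    (suc n + d) C d + 0                    ≡⟨ +-identityʳ _ ⟩
    (suc n + d) C d                        ∎
    where
    open ≡-Reasoning
    sumTo-zero : ∀ n → sumTo n (λ _ → 0) ≡ 0
    sumTo-zero zero    = refl
    sumTo-zero (suc n) = cong (_+ 0) (sumTo-zero n)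

  P-suc-d : ∀ d k n → P (suc d) k (suc n) ≡ P (suc d) k n + P d k (suc n)
  P-suc-d d k = conv-pascalʳ {k C_} {λ m → (m + d) C d} {λ m → (m + suc d) C suc d}
    (trans (nCn≡1 (suc d)) (sym (nCn≡1 d))) pascal
    where
    pascal : ∀ m → (suc m + suc d) C suc d ≡ (m + suc d) C suc d + (suc m + d) C d
    pascal m rewrite +-suc m d =
      trans (sym (nCk+nC[k+1]≡[n+1]C[k+1] (suc (m + d)) d)) (+-comm (suc (m + d) C d) _)

  P-absorb : ∀ d n → suc d * P (suc d) 0 n ≡ suc (n + d) * P d 0 n
  P-absorb d n rewrite P-binomial (suc d) n | P-binomial d n | +-suc n d = C-absorb (n + d) d

  -- F d k n = P_{d,k}(n-1) is the coefficient of xⁿ in x(1+x)ᵏ/(1-x)^(d+1), and F d k 0 = 0.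
  F : ℕ → ℕ → ℕ → ℕ
  F d k zero    = 0
  F d k (suc n) = P d k n

  P-suc-k : ∀ d k n → P d (suc k) n ≡ P d k n + F d k n
  P-suc-k d k zero    = trans (P-at-zero d (suc k)) (sym (cong (_+ 0) (P-at-zero d k)))
  P-suc-k d k (suc n) = conv-pascalˡ {k C_} {suc k C_} {λ m → (m + d) C d} refl
    (λ i → trans (sym (nCk+nC[k+1]≡[n+1]C[k+1] k i)) (+-comm (k C i) _)) n

  F-suc-k : ∀ d k n → F d (suc k) (suc n) ≡ F d k (suc n) + F d k n
  F-suc-k = P-suc-k

  F-suc-d : ∀ d k n → F (suc d) k (suc n) ≡ F (suc d) k n + F d k (suc n)
  F-suc-d d k zero    = trans (P-at-zero (suc d) k) (sym (P-at-zero d k))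
  F-suc-d d k (suc n) = P-suc-d d k n

  F-absorb : ∀ d n → suc d * F (suc d) 0 n ≡ (n + d) * F d 0 n
  F-absorb d zero    = trans (*-zeroʳ (suc d)) (sym (*-zeroʳ d))
  F-absorb d (suc n) = P-absorb d n

  F-one-pascal : ∀ d n → F (suc d) 1 n + F d 0 n ≡ F (suc d) 0 n + F (suc d) 0 n
  F-one-pascal d zero    = refl
  F-one-pascal d (suc n) rewrite F-suc-k (suc d) 0 n | F-suc-d d 0 n =
    +-assoc (F (suc d) 0 n + F d 0 (suc n)) _ _

  F-recurrence-k=0 : ∀ d n → suc d * F (suc d) 1 n + F d 0 n ≡ (n + n + d) * F d 0 n
  F-recurrence-k=0 d n = +-cancelʳ-≡ (suc d * v) _ _ (begin
    suc d * a + v + suc d * v ≡⟨ regroup₁ d a v ⟩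
    suc d * (a + v) + v       ≡⟨ cong (λ z → suc d * z + v) (F-one-pascal d n) ⟩
    suc d * (w + w) + v       ≡⟨ regroup₂ d w v ⟩
    suc d * w + suc d * w + v ≡⟨ cong (λ z → z + z + v) (F-absorb d n) ⟩
    (n + d) * v + (n + d) * v + v ≡⟨ regroup₃ n d v ⟩
    (n + n + d) * v + suc d * v ∎)
    where
    open ≡-Reasoning
    a = F (suc d) 1 n
    v = F d 0 n
    w = F (suc d) 0 n
    regroup₁ : ∀ d a v → suc d * a + v + suc d * v ≡ suc d * (a + v) + v
    regroup₁ = solve-∀
    regroup₂ : ∀ d w v → suc d * (w + w) + v ≡ suc d * w + suc d * w + v
    regroup₂ = solve-∀
    regroup₃ : ∀ n d v → (n + d) * v + (n + d) * v + v ≡ (n + n + d) * v + suc d * v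
    regroup₃ = solve-∀

  F-pred-pascal : ∀ d k n → k * F d (pred k) (suc n) + k * F d (pred k) n ≡ k * F d k (suc n)
  F-pred-pascal d zero    n = refl
  F-pred-pascal d (suc k) n =
    trans (sym (*-distribˡ-+ (suc k) (F d k (suc n)) (F d k n))) (cong (suc k *_) (sym (F-suc-k d k n)))

  recurrence-step : ∀ d k n A a₁ a₀ B b₁ b₀ x c₁ c₀ →
    A ≡ a₁ + a₀ → B ≡ b₁ + b₀ → b₁ ≡ b₀ + x → k * c₁ + k * c₀ ≡ k * x →
    suc (suc d) * a₁ + suc k * b₁ ≡ (suc n + suc n + suc d) * b₁ + k * c₁ →
    suc (suc d) * a₀ + suc k * b₀ ≡ (n + n + suc d) * b₀ + k * c₀ →
    suc (suc d) * A + suc (suc k) * B ≡ (suc n + suc n + suc d) * B + suc k * x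
  recurrence-step d k n _ a₁ a₀ _ _ b₀ x c₁ c₀ refl refl refl pascal eq₁ eq₀ = begin
    D * (a₁ + a₀) + suc (suc k) * (b₀ + x + b₀)
      ≡⟨ regroup₁ d k a₁ a₀ b₀ x ⟩
    (D * a₁ + suc k * (b₀ + x)) + (D * a₀ + suc k * b₀) + (b₀ + x + b₀)
      ≡⟨ cong₂ (λ u v → u + v + (b₀ + x + b₀)) eq₁ eq₀ ⟩
    (N₁ * (b₀ + x) + k * c₁) + (N₀ * b₀ + k * c₀) + (b₀ + x + b₀)
      ≡⟨ regroup₂ d k n b₀ x c₁ c₀ ⟩
    N₁ * (b₀ + x) + N₀ * b₀ + (b₀ + x + b₀) + (k * c₁ + k * c₀)
      ≡⟨ cong (N₁ * (b₀ + x) + N₀ * b₀ + (b₀ + x + b₀) +_) pascal ⟩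
    N₁ * (b₀ + x) + N₀ * b₀ + (b₀ + x + b₀) + k * x
      ≡⟨ regroup₃ d k n b₀ x ⟩
    N₁ * (b₀ + x + b₀) + suc k * x ∎
    where
    open ≡-Reasoning
    D = suc (suc d)
    N₁ = suc n + suc n + suc d
    N₀ = n + n + suc d
    regroup₁ : ∀ d k a₁ a₀ b₀ x → suc (suc d) * (a₁ + a₀) + suc (suc k) * (b₀ + x + b₀)
      ≡ (suc (suc d) * a₁ + suc k * (b₀ + x)) + (suc (suc d) * a₀ + suc k * b₀) + (b₀ + x + b₀)
    regroup₁ = solve-∀
    regroup₂ : ∀ d k n b₀ x c₁ c₀ →
      ((suc n + suc n + suc d) * (b₀ + x) + k * c₁) + ((n + n + suc d) * b₀ + k * c₀) + (b₀ + x + b₀)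
      ≡ (suc n + suc n + suc d) * (b₀ + x) + (n + n + suc d) * b₀ + (b₀ + x + b₀) + (k * c₁ + k * c₀)
    regroup₂ = solve-∀
    regroup₃ : ∀ d k n b₀ x →
      (suc n + suc n + suc d) * (b₀ + x) + (n + n + suc d) * b₀ + (b₀ + x + b₀) + k * x
      ≡ (suc n + suc n + suc d) * (b₀ + x + b₀) + suc k * x
    regroup₃ = solve-∀

  -- At n+1 the step k ↦ k+1 adds the identities at (k, n+1) and (k, n); Pascal's rule in k and in d
  -- accounts for the rest.
  F-recurrence : ∀ d k n →
    suc (suc d) * F (suc (suc d)) (suc k) n + suc k * F (suc d) k n
      ≡ (n + n + suc d) * F (suc d) k n + k * F d (pred k) n
  F-recurrence d zero    n       = begin
    suc (suc d) * F (suc (suc d)) 1 n + (F (suc d) 0 n + 0)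
      ≡⟨ cong (suc (suc d) * F (suc (suc d)) 1 n +_) (+-identityʳ _) ⟩
    suc (suc d) * F (suc (suc d)) 1 n + F (suc d) 0 n
      ≡⟨ F-recurrence-k=0 (suc d) n ⟩
    (n + n + suc d) * F (suc d) 0 n
      ≡⟨ +-identityʳ _ ⟨
    (n + n + suc d) * F (suc d) 0 n + 0 ∎
    where open ≡-Reasoning
  F-recurrence d (suc k) zero    = zeros (suc (suc d)) (suc (suc k)) (suc d) (suc k)
    where
    zeros : ∀ a b c e → a * 0 + b * 0 ≡ (0 + 0 + c) * 0 + e * 0
    zeros = solve-∀
  F-recurrence d (suc k) (suc n) = recurrence-step d k n
    (F D (suc (suc k)) (suc n)) (F D (suc k) (suc n)) (F D (suc k) n)
    (F (suc d) (suc k) (suc n)) (F (suc d) k (suc n)) (F (suc d) k n)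
    (F d k (suc n)) (F d (pred k) (suc n)) (F d (pred k) n)
    (F-suc-k D (suc k) n) (F-suc-k (suc d) k n) (F-suc-d d k n) (F-pred-pascal d k n)
    (F-recurrence d k (suc n)) (F-recurrence d k n)
    where
    D = suc (suc d)

  P-natPoly-zero : ∀ d → NatPoly d (λ n → d ! * P d 0 n)
  P-natPoly-zero zero    = NatPoly-cong (λ n → sym (trans (+-identityʳ _) (P-binomial 0 n))) (NatPoly-const 1)
  P-natPoly-zero (suc d) = NatPoly-cong step (NatPoly-*-linear 1 (suc d) (P-natPoly-zero d))
    where
    step : ∀ n → (1 * n + suc d) * (d ! * P d 0 n) ≡ suc d ! * P (suc d) 0 n
    step n = begin
      (1 * n + suc d) * (d ! * P d 0 n)     ≡⟨ regroup₁ n d (d !) (P d 0 n) ⟩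
      d ! * (suc (n + d) * P d 0 n)         ≡⟨ cong (d ! *_) (P-absorb d n) ⟨
      d ! * (suc d * P (suc d) 0 n)         ≡⟨ regroup₂ d (d !) (P (suc d) 0 n) ⟩
      suc d ! * P (suc d) 0 n               ∎
      where
      open ≡-Reasoning
      regroup₁ : ∀ n d g y → (1 * n + suc d) * (g * y) ≡ g * (suc (n + d) * y)
      regroup₁ = solve-∀
      regroup₂ : ∀ d g y → g * (suc d * y) ≡ (suc d * g) * y
      regroup₂ = solve-∀

  -- G e k = d! F d k for d = k + e + 1: the index e = d - k - 1 stays fixed along the recurrence in k.
  G : ℕ → ℕ → ℕ → ℕ
  G e k n = suc (k + e) ! * F (suc (k + e)) k n

  G-zero-natPoly : ∀ e → NatPoly (suc e) (G e 0)
  G-zero-natPoly zero    = NatPoly-cong (λ n → trans (normalise n) (cong (1 *_) (sym (F-1-0 n))))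
                                         (NatPoly-*-linear 1 0 (NatPoly-const 1))
    where
    F-1-0 : ∀ n → F 1 0 n ≡ n
    F-1-0 zero    = refl
    F-1-0 (suc n) = trans (P-binomial 1 n) (trans (nC1≡n (n + 1)) (+-comm n 1))
    normalise : ∀ n → (1 * n + 0) * 1 ≡ 1 * n
    normalise = solve-∀
  G-zero-natPoly (suc e) = NatPoly-cong step (NatPoly-*-linear 1 (suc e) (G-zero-natPoly e))
    where
    step : ∀ n → (1 * n + suc e) * G e 0 n ≡ G (suc e) 0 n
    step n = begin
      (1 * n + suc e) * (suc e ! * F (suc e) 0 n)   ≡⟨ regroup₁ n e (suc e !) (F (suc e) 0 n) ⟩
      suc e ! * ((n + suc e) * F (suc e) 0 n)       ≡⟨ cong (suc e ! *_) (F-absorb (suc e) n) ⟨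
      suc e ! * (suc (suc e) * F (suc (suc e)) 0 n) ≡⟨ regroup₂ (suc e) (suc e !) (F (suc (suc e)) 0 n) ⟩
      suc (suc e) ! * F (suc (suc e)) 0 n           ∎
      where
      open ≡-Reasoning
      regroup₁ : ∀ n e g y → (1 * n + suc e) * (g * y) ≡ g * ((n + suc e) * y)
      regroup₁ = solve-∀
      regroup₂ : ∀ d g y → g * (suc d * y) ≡ (suc d * g) * y
      regroup₂ = solve-∀

  F-recurrence′ : ∀ e k n →
    suc (suc (k + e)) * F (suc (suc (k + e))) (suc k) n
      ≡ (n + n + e) * F (suc (k + e)) k n + k * F (k + e) (pred k) n
  F-recurrence′ e k n = +-cancelʳ-≡ (suc k * v) _ _
    (trans (F-recurrence (k + e) k n) (regroup n k e v (k * F (k + e) (pred k) n)))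
    where
    v = F (suc (k + e)) k n
    regroup : ∀ n k e v c → (n + n + suc (k + e)) * v + c ≡ (n + n + e) * v + c + suc k * v
    regroup = solve-∀

  G-one : ∀ e n → G e 1 n ≡ (2 * n + e) * G e 0 n
  G-one e n = begin
    (suc (suc e) * suc e !) * F (suc (suc e)) 1 n      ≡⟨ regroup₁ (suc (suc e)) (suc e !) _ ⟩
    suc e ! * (suc (suc e) * F (suc (suc e)) 1 n)      ≡⟨ cong (suc e ! *_) (F-recurrence′ e 0 n) ⟩
    suc e ! * ((n + n + e) * F (suc e) 0 n + 0)        ≡⟨ regroup₂ (suc e !) n e _ ⟩
    (2 * n + e) * G e 0 n                              ∎
    where
    open ≡-Reasoning
    regroup₁ : ∀ a g y → (a * g) * y ≡ g * (a * y)
    regroup₁ = solve-∀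
    regroup₂ : ∀ g n e y → g * ((n + n + e) * y + 0) ≡ (2 * n + e) * (g * y)
    regroup₂ = solve-∀

  G-suc-suc : ∀ e k n →
    G e (suc (suc k)) n ≡ (2 * n + e) * G e (suc k) n + (suc k * suc (suc (k + e))) * G e k n
  G-suc-suc e k n = begin
    (a * (h * g)) * F a (suc (suc k)) n
      ≡⟨ regroup₁ a h g _ ⟩
    (h * g) * (a * F a (suc (suc k)) n)
      ≡⟨ cong ((h * g) *_) (F-recurrence′ e (suc k) n) ⟩
    (h * g) * ((n + n + e) * F h (suc k) n + suc k * F (suc (k + e)) k n)
      ≡⟨ regroup₂ h g n e _ (suc k) _ ⟩
    (2 * n + e) * G e (suc k) n + (suc k * h) * G e k n ∎
    where
    open ≡-Reasoning
    a = suc (suc (suc (k + e)))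
    h = suc (suc (k + e))
    g = suc (k + e) !
    regroup₁ : ∀ a h g y → (a * (h * g)) * y ≡ (h * g) * (a * y)
    regroup₁ = solve-∀
    regroup₂ : ∀ h g n e y c z →
      (h * g) * ((n + n + e) * y + c * z) ≡ (2 * n + e) * ((h * g) * y) + (c * h) * (g * z)
    regroup₂ = solve-∀

  G-natPoly : ∀ e k → NatPoly (suc (k + e)) (G e k) × NatPoly (suc (suc (k + e))) (G e (suc k))
  G-natPoly e zero    = G₀ , NatPoly-cong (λ n → sym (G-one e n)) (NatPoly-*-linear 2 e G₀)
    where
    G₀ = G-zero-natPoly e
  G-natPoly e (suc k) = Gₖ₊₁ , NatPoly-cong (λ n → sym (G-suc-suc e k n))
    (NatPoly-+ (NatPoly-*-linear 2 e Gₖ₊₁)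
               (NatPoly-weaken (≤-trans (n≤1+n _) (n≤1+n _)) (NatPoly-scale (suc k * suc (suc (k + e))) Gₖ)))
    where
    Gₖ   = proj₁ (G-natPoly e k)
    Gₖ₊₁ = proj₂ (G-natPoly e k)

  F-natPoly : ∀ {d k} → k < d → NatPoly d (λ n → d ! * F d k n)
  F-natPoly {k = k} k<d with m≤n⇒∃[o]m+o≡n k<d
  ... | e , refl = proj₁ (G-natPoly e k)

  P-natPoly : ∀ {d} k → k ≤ d → NatPoly d (λ n → d ! * P d k n)
  P-natPoly {d} zero    _    = P-natPoly-zero d
  P-natPoly {d} (suc k) k<d = NatPoly-cong step (NatPoly-+ (P-natPoly k (<⇒≤ k<d)) (F-natPoly k<d))
    where
    step : ∀ n → d ! * P d k n + d ! * F d k n ≡ d ! * P d (suc k) n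
    step n = trans (sym (*-distribˡ-+ (d !) (P d k n) (F d k n))) (cong (d ! *_) (sym (P-suc-k d k n)))


open IntegerEvaluation
open Combinatorics using (F; P-suc-k; F-natPoly; P-natPoly)
import Data.Nat as ℕ
open import Data.Nat.Properties using (<⇒≤; *-distribˡ-+)
open import Data.Integer using (+_)
open import Data.Integer.Properties using (pos-+; i≤i+j)
open import Data.Product using (_,_; proj₁; proj₂)
open import Relation.Binary.PropositionalEquality

coeffs-suc-k : ∀ {d k} (k<d : k < d) (c c′ : Fin (suc d) → ℤ) → IsCoeffs d k c → IsCoeffs d (suc k) c′ →
               ∀ j → c′ j ≡ c j ℤ.+ proj₁ (natPoly⇒coeffs (F-natPoly k<d)) j
coeffs-suc-k {d} {k} k<d c c′ c-coeffs c′-coeffs = evalℤ-injective (suc d) c′ (λ j → c j ℤ.+ r j) λ n → begin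
  evalℤ (suc d) c′ (suc n)
    ≡⟨ c′-coeffs (suc n) ⟨
  + (d ℕ.! ℕ.* P d (suc k) (suc n))
    ≡⟨ cong (λ x → + (d ℕ.! ℕ.* x)) (P-suc-k d k (suc n)) ⟩
  + (d ℕ.! ℕ.* (P d k (suc n) ℕ.+ F d k (suc n)))
    ≡⟨ cong +_ (*-distribˡ-+ (d ℕ.!) (P d k (suc n)) (F d k (suc n))) ⟩
  + (d ℕ.! ℕ.* P d k (suc n) ℕ.+ d ℕ.! ℕ.* F d k (suc n))
    ≡⟨ pos-+ (d ℕ.! ℕ.* P d k (suc n)) _ ⟩
  + (d ℕ.! ℕ.* P d k (suc n)) ℤ.+ + (d ℕ.! ℕ.* F d k (suc n))
    ≡⟨ cong₂ ℤ._+_ (c-coeffs (suc n)) (proj₂ (natPoly⇒coeffs (F-natPoly k<d)) (suc n)) ⟩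
  evalℤ (suc d) c (suc n) ℤ.+ evalℤ (suc d) r (suc n)
    ≡⟨ evalℤ-+ (suc d) c r (suc n) ⟨
  evalℤ (suc d) (λ j → c j ℤ.+ r j) (suc n) ∎
  where
  open ≡-Reasoning
  r = proj₁ (natPoly⇒coeffs (F-natPoly k<d))

proposition4p4 : (d : ℕ) → 1 ≤ d → (k : ℕ) → k < d →
    (Σ (Fin (suc d) → ℤ) (IsCoeffs d k)) × (Σ (Fin (suc d) → ℤ) (IsCoeffs d (suc k))) ×
    ((c c′ : Fin (suc d) → ℤ) → IsCoeffs d k c → IsCoeffs d (suc k) c′ →
      (j : Fin (suc d)) → c j ℤ.≤ c′ j)
proposition4p4 d _ k k<d =
    natPoly⇒coeffs (P-natPoly k (<⇒≤ k<d))
  , natPoly⇒coeffs (P-natPoly (suc k) k<d)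
  , λ c c′ c-coeffs c′-coeffs j →
      subst (c j ℤ.≤_) (sym (coeffs-suc-k k<d c c′ c-coeffs c′-coeffs j)) (i≤i+j (c j) (proj₁ (natPoly⇒coeffs (F-natPoly k<d)) j))
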